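{- Let $n\ge 13$, let $Q$ be a query graph on an $n$-element vertex set $V$ with minimum degree at least $n-3$, and suppose the answers $q(x,y)$ to all pairs $xy\in E(Q)$ have been received for some hidden tree on $V$. Then there are no consistent trees $T_0$, $T_1$ and distinct vertices $a,b,c,d$ such that $a,b,c,d$ lie on a path of $T_0$ in this order (not necessarily consecutively), while in $T_1$ the vertices $b,a,d$ form a path $bad$ (i.e. $ba$ and $ad$ are edges of $T_1$), $c$ has distance $2$ from $a$ in $T_1$, and $c$ is adjacent in $T_1$ neither to $b$ nor to $d$.
   Context: The answer $q(x,y)$ to a queried pair is the distance of $x$ and $y$ in the hidden tree. A tree on $V$ is consistent if for every edge $xy$ of $Q$ its distance between $x$ and $y$ equals $q(x,y)$. -}

module Defs where

open import Data.Nat using (ℕ; zero; suc; _≤_; _∸_)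
open import Data.Fin using (Fin)
open import Data.Bool using (Bool; true; false; if_then_else_)
open import Data.List using (List; []; _∷_; _∷ʳ_; map; length)
open import Data.Nat.ListAction using (sum)
open import Data.List.Relation.Unary.Linked using (Linked)
open import Data.List.Relation.Unary.Unique.Propositional using (Unique)
open import Data.List.Relation.Binary.Sublist.Propositional using (_⊆_)
open import Data.Product using (Σ; ∃; _×_; ∃-syntax)
open import Relation.Binary.PropositionalEquality using (_≡_)
open import Relation.Nullary using (¬_)

open import Data.List using () renaming (allFin to allFinL) public

record Graph (n : ℕ) : Set where
  field
    adj   : Fin n → Fin n → Bool
    sym   : ∀ x y → adj x y ≡ adj y x
    irrefl : ∀ x → adj x x ≡ false
open Graph public

Adj : ∀ {n} → Graph n → Fin n → Fin n → Set
Adj G x y = adj G x y ≡ true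

degree : ∀ {n} → Graph n → Fin n → ℕ
degree {n} G x = sum (map (λ y → if adj G x y then 1 else 0) (allFinL n))

MinDegreeAtLeast : ∀ {n} → Graph n → ℕ → Set
MinDegreeAtLeast G k = ∀ x → k ≤ degree G x

data Walk {n} (G : Graph n) : Fin n → Fin n → ℕ → Set where
  nil  : ∀ {x} → Walk G x x 0
  cons : ∀ {x z y k} → Adj G x z → Walk G z y k → Walk G x y (suc k)

Dist : ∀ {n} → Graph n → Fin n → Fin n → ℕ → Set
Dist G x y d = Walk G x y d × (∀ k → Walk G x y k → d ≤ k)

Connected : ∀ {n} → Graph n → Set
Connected G = ∀ x y → ∃[ k ] Walk G x y k

IsPath : ∀ {n} → Graph n → List (Fin n) → Set
IsPath G vs = Unique vs × Linked (Adj G) vs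

-- a cycle: path u, m₁, …, mⱼ, v with j ≥ 1 (so ≥ 3 vertices) and v adjacent to u
HasCycle : ∀ {n} → Graph n → Set
HasCycle {n} G = Σ (Fin n) λ u → Σ (Fin n) λ v → Σ (List (Fin n)) λ mid →
  (1 ≤ length mid) × IsPath G (u ∷ (mid ∷ʳ v)) × Adj G v u

IsTree : ∀ {n} → Graph n → Set
IsTree G = Connected G × ¬ HasCycle G

-- T is consistent with the answers (distances in hidden tree H) on query graph Q
Consistent : ∀ {n} → Graph n → Graph n → Graph n → Set
Consistent {n} Q H T = ∀ (x y : Fin n) → Adj Q x y →
  ∃[ d ] (Dist H x y d × Dist T x y d)

OnPathInOrder : ∀ {n} → Graph n → Fin n → Fin n → Fin n → Fin n → Set
OnPathInOrder {n} T a b c d =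
  Σ (List (Fin n)) λ P → IsPath T P × ((a ∷ b ∷ c ∷ d ∷ []) ⊆ P)

{-# OPTIONS --safe #-}
module Submission where

-- Every vertex has at most three non-neighbours in Q (itself included), so for n ≥ 13 the
-- vertices a, b, c, d have a common Q-neighbour x, and every consistent tree gives each of them
-- its H-distance to x.  In a tree the distance to x changes by exactly one along each edge, and
-- a vertex has only one neighbour that is not farther from x; so along a path the distance to x,
-- once it has increased, keeps increasing.  On the T₀-path through a, b, c, d this excludes both
-- dist a < dist b ≥ dist d and dist b < dist c ≥ dist d.  In T₁, however, either b is farther
-- from x than a, giving the first pattern, or b is the parent of a, and then d, the middle
-- vertex e of the path from a to c, and c all lie beyond a, giving the second.

open import Defs hiding (sym)
open import Data.Nat using (ℕ; zero; suc; _≤_; _<_; _∸_; _+_; _*_; z≤n; s≤s)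
open import Data.Nat.Properties
  using (+-commutativeSemigroup; module ≤-Reasoning;
         ≤-refl; ≤-reflexive; ≤-trans; ≤-antisym; ≤-total; ≤-pred; <-trans; <-asym; <-cmp; <⇒≤; <⇒≱; ≤⇒≯; 1+n≰n; n≤1+n; m≤n⇒m≤1+n; m≤n+m∸n;
         +-comm; +-mono-≤; +-monoʳ-≤; +-cancelˡ-≤)
open import Data.Nat.ListAction using (sum)
open import Algebra.Properties.CommutativeSemigroup +-commutativeSemigroup using (interchange)
open import Data.Bool using (Bool; true; false; if_then_else_)
open import Data.Bool.Properties using () renaming (_≟_ to _≟ᵇ_)
open import Data.Fin using (Fin; _≟_)
open import Data.Fin.Properties using (any?)
open import Data.List using (List; []; _∷_; _++_; [_]; map; length)
open import Data.List.Properties using (++-assoc; length-tabulate)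
open import Data.List.Relation.Unary.All using (All; []; _∷_; all?)
import Data.List.Relation.Unary.All as All
open import Data.List.Relation.Unary.All.Properties using (¬Any⇒All¬; ++⁻ˡ)
open import Data.List.Relation.Unary.Any using (here; there; toSum)
open import Data.List.Relation.Unary.AllPairs using (AllPairs; []; _∷_)
open import Data.List.Relation.Unary.Linked using (Linked; []; [-]; _∷_)
import Data.List.Relation.Unary.Linked as Linked
open import Data.List.Relation.Unary.Linked.Properties using (Linked⇒AllPairs)
open import Data.List.Relation.Unary.Unique.Propositional using (Unique)
open import Data.List.Relation.Unary.Unique.Propositional.Properties using (Unique[x∷xs]⇒x∉xs)
open import Data.List.Membership.Propositional using (_∈_; _∉_)
open import Data.List.Membership.Propositional.Properties using (∈-∃++)
open import Data.List.Relation.Binary.Sublist.Propositional using (_⊆_; []; _∷_; _∷ʳ_; ⊆-refl; ⊆-trans)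
open import Data.List.Relation.Binary.Sublist.Propositional.Properties using (All-resp-⊆)
open import Data.Product using (Σ; _×_; _,_; proj₁; proj₂; ∃-syntax; uncurry)
open import Data.Sum using (_⊎_; inj₁; inj₂; [_,_]′)
open import Data.Empty using (⊥; ⊥-elim)
open import Function using (id; _∘_; _on_)
open import Relation.Binary.PropositionalEquality
  using (_≡_; _≢_; refl; sym; trans; cong; cong₂; subst; subst₂)
open import Relation.Binary.Definitions using (tri<; tri≈; tri>)
open import Relation.Nullary using (¬_; Dec; yes; no; contradiction)
open import Relation.Nullary.Decidable using (_×-dec_; map′)
open import Relation.Unary using (Pred; Decidable)

least-witness : ∀ {p} {P : Pred ℕ p} → Decidable P →
                ∀ {k} → P k → ∃[ m ] (P m × (∀ j → P j → m ≤ j))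
least-witness P? {zero} p0 = 0 , p0 , λ _ _ → z≤n
least-witness P? {suc k} pk with P? 0
... | yes p0 = 0 , p0 , λ _ _ → z≤n
... | no ¬p0 with least-witness (P? ∘ suc) pk
...   | m , pm , minimal = suc m , pm , λ { zero p0 → contradiction p0 ¬p0 ; (suc j) pj → s≤s (minimal j pj) }

AllPairs-pair : ∀ {a r} {A : Set a} {R : A → A → Set r} {x y : A} {xs : List A} →
                AllPairs R xs → (x ∷ y ∷ []) ⊆ xs → R x y
AllPairs-pair (_ ∷ pxs) (_ ∷ʳ xy⊆xs) = AllPairs-pair pxs xy⊆xs
AllPairs-pair (Rx ∷ _) (refl ∷ y⊆xs) = All.head (All-resp-⊆ y⊆xs Rx)

module _ {a} {A : Set a} where

  count-false : (A → Bool) → List A → ℕ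
  count-false p xs = sum (map (λ x → if p x then 0 else 1) xs)

  count-true+count-false : ∀ (p : A → Bool) xs →
    sum (map (λ x → if p x then 1 else 0) xs) + count-false p xs ≡ length xs
  count-true+count-false p [] = refl
  count-true+count-false p (x ∷ xs) =
    trans (interchange (if p x then 1 else 0) _ _ _)
          (cong₂ _+_ (indicators-sum (p x)) (count-true+count-false p xs))
    where
    indicators-sum : ∀ b → (if b then 1 else 0) + (if b then 0 else 1) ≡ 1
    indicators-sum true = refl
    indicators-sum false = refl

  ¬All⇒0<count-false : ∀ (p : A → Bool) xs → ¬ All (λ x → p x ≡ true) xs → 0 < count-false p xs
  ¬All⇒0<count-false p [] ¬all = contradiction [] ¬all
  ¬All⇒0<count-false p (x ∷ xs) ¬all with p x in px
  ... | true = ¬All⇒0<count-false p xs (λ all → ¬all (px ∷ all))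
  ... | false = s≤s z≤n

  sum-map-+ : ∀ (f g : A → ℕ) xs → sum (map (λ x → f x + g x) xs) ≡ sum (map f xs) + sum (map g xs)
  sum-map-+ f g [] = refl
  sum-map-+ f g (x ∷ xs) = trans (cong (f x + g x +_) (sum-map-+ f g xs)) (interchange (f x) (g x) _ _)

  sum-map-≤ : ∀ {f : A → ℕ} {k} → (∀ x → f x ≤ k) → ∀ xs → sum (map f xs) ≤ length xs * k
  sum-map-≤ f≤k [] = z≤n
  sum-map-≤ f≤k (x ∷ xs) = +-mono-≤ (f≤k x) (sum-map-≤ f≤k xs)

module _ {n : ℕ} (G : Graph n) where

  open import Data.List.Membership.DecPropositional (_≟_ {n}) using (_∈?_)

  non-neighbours : List (Fin n) → Fin n → ℕ
  non-neighbours L v = count-false (adj G v) L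

  length≤non-neighbours : ∀ vs → (∀ y → ¬ All (λ v → Adj G v y) vs) →
                   ∀ L → length L ≤ sum (map (non-neighbours L) vs)
  length≤non-neighbours vs none [] = z≤n
  length≤non-neighbours vs none (y ∷ L) = begin
    suc (length L)
      ≤⟨ +-mono-≤ (¬All⇒0<count-false (λ v → adj G v y) vs (none y)) (length≤non-neighbours vs none L) ⟩
    count-false (λ v → adj G v y) vs + sum (map (non-neighbours L) vs)
      ≡⟨ sum-map-+ (λ v → if adj G v y then 0 else 1) (non-neighbours L) vs ⟨
    sum (map (non-neighbours (y ∷ L)) vs) ∎
    where open ≤-Reasoning

  non-neighbours≤ : ∀ {k} → MinDegreeAtLeast G (n ∸ k) → ∀ v → non-neighbours (allFinL n) v ≤ k
  non-neighbours≤ {k} δ v = +-cancelˡ-≤ (degree G v) _ _ (begin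
    degree G v + non-neighbours (allFinL n) v  ≡⟨ count-true+count-false (adj G v) (allFinL n) ⟩
    length (allFinL n)                  ≡⟨ length-tabulate (λ i → i) ⟩
    n                                   ≤⟨ m≤n+m∸n n k ⟩
    k + (n ∸ k)                         ≤⟨ +-monoʳ-≤ k (δ v) ⟩
    k + degree G v                      ≡⟨ +-comm k (degree G v) ⟩
    degree G v + k                      ∎)
    where open ≤-Reasoning

  common-neighbour : ∀ {k} → MinDegreeAtLeast G (n ∸ k) →
                     (vs : List (Fin n)) → length vs * k < n → ∃[ x ] All (λ v → Adj G v x) vs
  common-neighbour {k} δ vs small with any? (λ x → all? (λ v → adj G v x ≟ᵇ true) vs)
  ... | yes found = found
  ... | no none = contradiction small (≤⇒≯ (begin
    n                                  ≡⟨ length-tabulate (λ i → i) ⟨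
    length (allFinL n)                 ≤⟨ length≤non-neighbours vs (λ y all → none (y , all)) (allFinL n) ⟩
    sum (map (non-neighbours (allFinL n)) vs) ≤⟨ sum-map-≤ (non-neighbours≤ δ) vs ⟩
    length vs * k                      ∎))
    where open ≤-Reasoning

  Adj-sym : ∀ {u v} → Adj G u v → Adj G v u
  Adj-sym {u} {v} uv = trans (Graph.sym G v u) uv

  Adj-irrefl : ∀ {u} → ¬ Adj G u u
  Adj-irrefl {u} uu with trans (sym uu) (irrefl G u)
  ... | ()

  verticesAfter : ∀ {u y k} → Walk G u y k → List (Fin n)
  verticesAfter nil = []
  verticesAfter (cons {z = z} _ w) = z ∷ verticesAfter w

  vertices : ∀ {u y k} → Walk G u y k → List (Fin n)
  vertices {u} w = u ∷ verticesAfter w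

  vertices-linked : ∀ {u y k} (w : Walk G u y k) → Linked (Adj G) (vertices w)
  vertices-linked nil = [-]
  vertices-linked (cons e w) = e ∷ vertices-linked w

  end∈vertices : ∀ {u y k} (w : Walk G u y k) → y ∈ vertices w
  end∈vertices nil = here refl
  end∈vertices (cons _ w) = there (end∈vertices w)

  ∈vertices⇒walk : ∀ {u v y k} (w : Walk G u y k) → v ∈ vertices w → ∃[ j ] (j ≤ k × Walk G v y j)
  ∈vertices⇒walk {k = k} w (here refl) = k , ≤-refl , w
  ∈vertices⇒walk (cons _ w) (there v∈w) with ∈vertices⇒walk w v∈w
  ... | j , j≤k , w′ = j , m≤n⇒m≤1+n j≤k , w′

  shortest⇒unique : ∀ {u y k} (w : Walk G u y k) → (∀ j → Walk G u y j → k ≤ j) → Unique (vertices w)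
  shortest⇒unique nil _ = [] ∷ []
  shortest⇒unique {u} {k = suc k} (cons e w) shortest =
    ¬Any⇒All¬ (vertices w) u∉w ∷ shortest⇒unique w (λ j w′ → ≤-pred (shortest (suc j) (cons e w′)))
    where
    u∉w : u ∉ vertices w
    u∉w u∈w with ∈vertices⇒walk w u∈w
    ... | j , j≤k , w′ = <⇒≱ (s≤s j≤k) (shortest j w′)

  Dist⇒IsPath : ∀ {u y k} ((w , _) : Dist G u y k) → IsPath G (vertices w)
  Dist⇒IsPath (w , shortest) = shortest⇒unique w shortest , vertices-linked w

  walk? : ∀ k u y → Dec (Walk G u y k)
  walk? zero u y with u ≟ y
  ... | yes refl = yes nil
  ... | no u≢y = no λ { nil → u≢y refl }
  walk? (suc k) u y =
    map′ (λ (_ , e , w) → cons e w) (λ { (cons e w) → _ , e , w })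
         (any? (λ z → adj G u z ≟ᵇ true ×-dec walk? k z y))

  Connected⇒Dist : Connected G → ∀ u y → ∃[ d ] Dist G u y d
  Connected⇒Dist connected u y = least-witness (λ k → walk? k u y) (proj₂ (connected u y))

  Dist-unique : ∀ {u y d d′} → Dist G u y d → Dist G u y d′ → d ≡ d′
  Dist-unique (w , shortest) (w′ , shortest′) = ≤-antisym (shortest _ w′) (shortest′ _ w)

  IsPath-++⁻ˡ : ∀ xs {ys} → IsPath G (xs ++ ys) → IsPath G xs
  IsPath-++⁻ˡ [] _ = [] , []
  IsPath-++⁻ˡ (x ∷ []) _ = [] ∷ [] , [-]
  IsPath-++⁻ˡ (x ∷ y ∷ xs) (x∉ ∷ unique , xy ∷ linked) with IsPath-++⁻ˡ (y ∷ xs) (unique , linked)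
  ... | unique′ , linked′ = ++⁻ˡ (y ∷ xs) x∉ ∷ unique′ , xy ∷ linked′

  closing-edge⇒cycle : ∀ {h m w M} → IsPath G (h ∷ m ∷ M) → w ∈ M → Adj G w h → HasCycle G
  closing-edge⇒cycle {h} {m} {w} path w∈M wh with ∈-∃++ w∈M
  ... | ys , zs , refl = h , w , m ∷ ys , s≤s z≤n , IsPath-++⁻ˡ (h ∷ m ∷ ys ++ [ w ]) path′ , wh
    where
    path′ : IsPath G ((h ∷ m ∷ ys ++ [ w ]) ++ zs)
    path′ = subst (IsPath G) (cong (λ t → h ∷ m ∷ t) (sym (++-assoc ys [ w ] zs))) path

  -- Extend the first path backwards along R until R meets it; the meeting vertex closes a cycle.
  meeting-paths⇒cycle : ∀ {h m z M R} → IsPath G (h ∷ m ∷ M) → IsPath G (h ∷ R) → m ∉ R →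
                        z ∈ m ∷ M → z ∈ R → HasCycle G
  meeting-paths⇒cycle {h} {m} {z} {M} {r ∷ R}
                      hmM@(uniqueₘ , linkedₘ) (h∉rR ∷ uniqueᵣ , hr ∷ linkedᵣ) m∉rR z∈mM z∈rR
    with r ∈? m ∷ M
  ... | yes (here r≡m) = contradiction (here (sym r≡m)) m∉rR
  ... | yes (there r∈M) = closing-edge⇒cycle hmM r∈M (Adj-sym hr)
  ... | no r∉mM = meeting-paths⇒cycle rhmM (uniqueᵣ , linkedᵣ) h∉R (there z∈mM) z∈R
    where
    h∉r∷R : h ∉ r ∷ R
    h∉r∷R = Unique[x∷xs]⇒x∉xs (h∉rR ∷ uniqueᵣ)
    rhmM : IsPath G (r ∷ h ∷ m ∷ M)
    rhmM = ((λ r≡h → h∉r∷R (here (sym r≡h))) ∷ ¬Any⇒All¬ (m ∷ M) r∉mM) ∷ uniqueₘ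
         , Adj-sym hr ∷ linkedₘ
    h∉R : h ∉ R
    h∉R = h∉r∷R ∘ there
    z∈R : z ∈ R
    z∈R = [ (λ z≡r → contradiction (subst (_∈ m ∷ M) z≡r z∈mM) r∉mM) , id ]′ (toSum z∈rR)

  module Distance (connected : Connected G) (root : Fin n) where

    dist : Fin n → ℕ
    dist v = proj₁ (Connected⇒Dist connected v root)

    dist-spec : ∀ v → Dist G v root (dist v)
    dist-spec v = proj₂ (Connected⇒Dist connected v root)

    geodesic : ∀ v → Walk G v root (dist v)
    geodesic v = proj₁ (dist-spec v)

    dist-min : ∀ {v k} → Walk G v root k → dist v ≤ k
    dist-min {v} w = proj₂ (dist-spec v) _ w

    dist-adj : ∀ {u v} → Adj G u v → dist u ≤ suc (dist v)
    dist-adj {v = v} uv = dist-min (cons uv (geodesic v))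

    dist≡0⇒root : ∀ {v} → dist v ≡ 0 → v ≡ root
    dist≡0⇒root {v} dv≡0 with subst (Walk G v root) dv≡0 (geodesic v)
    ... | nil = refl

    verticesAfter-closer : ∀ {u v k} (w : Walk G v root k) → u ∈ verticesAfter w → dist u < k
    verticesAfter-closer (cons _ w) u∈w with ∈vertices⇒walk w u∈w
    ... | j , j≤k , w′ = s≤s (≤-trans (dist-min w′) j≤k)

    geodesic-extend : ∀ {h u} → Adj G h u → dist u ≤ dist h → IsPath G (h ∷ vertices (geodesic u))
    geodesic-extend {h} {u} hu du≤dh with Dist⇒IsPath (dist-spec u)
    ... | unique , linked = ¬Any⇒All¬ (vertices (geodesic u)) h∉ ∷ unique , hu ∷ linked
      where
      h∉ : h ∉ vertices (geodesic u)
      h∉ (here refl) = Adj-irrefl hu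
      h∉ (there h∈) = <⇒≱ (verticesAfter-closer (geodesic u) h∈) du≤dh

    two-geodesics⇒cycle : ∀ {h u v} → Adj G h u → Adj G h v → u ≢ v →
                          dist v ≤ dist u → dist u ≤ dist h → HasCycle G
    two-geodesics⇒cycle {u = u} {v} hu hv u≢v dv≤du du≤dh =
      meeting-paths⇒cycle (geodesic-extend hu du≤dh) (geodesic-extend hv (≤-trans dv≤du du≤dh))
        u∉ (end∈vertices (geodesic u)) (end∈vertices (geodesic v))
      where
      u∉ : u ∉ vertices (geodesic v)
      u∉ (here u≡v) = u≢v u≡v
      u∉ (there u∈) = <⇒≱ (verticesAfter-closer (geodesic v) u∈) dv≤du

    module _ (acyclic : ¬ HasCycle G) where

      lower-neighbour-unique : ∀ {h u v} → Adj G h u → Adj G h v →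
                               dist u ≤ dist h → dist v ≤ dist h → u ≡ v
      lower-neighbour-unique {u = u} {v} hu hv du≤dh dv≤dh with u ≟ v
      ... | yes u≡v = u≡v
      ... | no u≢v with ≤-total (dist v) (dist u)
      ...   | inj₁ dv≤du = ⊥-elim (acyclic (two-geodesics⇒cycle hu hv u≢v dv≤du du≤dh))
      ...   | inj₂ du≤dv = ⊥-elim (acyclic (two-geodesics⇒cycle hv hu (u≢v ∘ sym) du≤dv dv≤dh))

      private
        ≡suc⇒< : ∀ {m k} → m ≡ suc k → k < m
        ≡suc⇒< refl = ≤-refl

      -- Generalised over k so that the geodesic from v can be matched on.
      equidistant-neighbour : ∀ {u v k} → Adj G u v → dist u ≡ k → dist v ≡ k → Walk G v root k → ⊥
      equidistant-neighbour uv du≡0 _ nil = Adj-irrefl (subst (λ t → Adj G t root) (dist≡0⇒root du≡0) uv)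
      equidistant-neighbour {u} uv du≡1+k dv≡1+k (cons {z = p} vp w) = 1+n≰n (begin
        suc _   ≡⟨ du≡1+k ⟨
        dist u  ≡⟨ cong dist u≡p ⟩
        dist p  ≤⟨ dist-min w ⟩
        _       ∎)
        where
        open ≤-Reasoning
        u≡p : u ≡ p
        u≡p = lower-neighbour-unique (Adj-sym uv) vp (≤-reflexive (trans du≡1+k (sym dv≡1+k)))
                (≤-trans (dist-min w) (≤-trans (n≤1+n _) (≤-reflexive (sym dv≡1+k))))

      adj⇒dist≢ : ∀ {u v} → Adj G u v → dist u ≢ dist v
      adj⇒dist≢ {v = v} uv du≡dv = equidistant-neighbour uv du≡dv refl (geodesic v)

      adj⇒dist-suc : ∀ {u v} → Adj G u v → dist v ≡ suc (dist u) ⊎ dist u ≡ suc (dist v)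
      adj⇒dist-suc {u} {v} uv with <-cmp (dist u) (dist v)
      ... | tri< du<dv _ _ = inj₁ (≤-antisym (dist-adj (Adj-sym uv)) du<dv)
      ... | tri≈ _ du≡dv _ = ⊥-elim (adj⇒dist≢ uv du≡dv)
      ... | tri> _ _ du>dv = inj₂ (≤-antisym (dist-adj uv) du>dv)

      ascent-continues : ∀ {u v w} → Adj G u v → Adj G v w → u ≢ w →
                         dist v ≡ suc (dist u) → dist w ≡ suc (dist v)
      ascent-continues uv vw u≢w dv≡1+du with adj⇒dist-suc vw
      ... | inj₁ dw≡1+dv = dw≡1+dv
      ... | inj₂ dv≡1+dw = ⊥-elim (u≢w (lower-neighbour-unique (Adj-sym uv) vw
                                          (<⇒≤ (≡suc⇒< dv≡1+du)) (<⇒≤ (≡suc⇒< dv≡1+dw))))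

      ascending : ∀ {u v vs} → IsPath G (u ∷ v ∷ vs) → dist v ≡ suc (dist u) →
                  Linked (_<_ on dist) (u ∷ v ∷ vs)
      ascending {vs = []} _ dv≡1+du = ≡suc⇒< dv≡1+du ∷ [-]
      ascending {vs = w ∷ vs} ((_ ∷ u≢w ∷ _) ∷ unique , uv ∷ vw ∷ linked) dv≡1+du =
        ≡suc⇒< dv≡1+du ∷ ascending (unique , vw ∷ linked) (ascent-continues uv vw u≢w dv≡1+du)

      ascending-ordered : ∀ {u v vs q r} → IsPath G (u ∷ v ∷ vs) → dist v ≡ suc (dist u) →
                          (q ∷ r ∷ []) ⊆ v ∷ vs → dist q < dist r
      ascending-ordered {u} path dv≡1+du qr⊆vvs =
        AllPairs-pair (Linked⇒AllPairs <-trans (ascending path dv≡1+du)) (u ∷ʳ qr⊆vvs)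

      path-ascent-persists : ∀ {P p q r} → IsPath G P → (p ∷ q ∷ r ∷ []) ⊆ P →
                             dist p < dist q → dist q < dist r
      path-ascent-persists {_ ∷ _} (_ ∷ unique , linked) (_ ∷ʳ pqr⊆P) dp<dq =
        path-ascent-persists (unique , Linked.tail linked) pqr⊆P dp<dq
      path-ascent-persists {_ ∷ []} _ (refl ∷ ())
      path-ascent-persists {y ∷ z ∷ zs} path@(_ , yz ∷ _) (refl ∷ refl ∷ r⊆zs) dp<dq =
        [ (λ dz≡1+dy → ascending-ordered path dz≡1+dy (refl ∷ r⊆zs))
        , (λ dy≡1+dz → contradiction dp<dq (<-asym (≡suc⇒< dy≡1+dz))) ]′ (adj⇒dist-suc yz)
      path-ascent-persists {y ∷ z ∷ zs} path@(_ ∷ unique , yz ∷ linked) (refl ∷ z ∷ʳ qr⊆zs) dp<dq =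
        [ (λ dz≡1+dy → ascending-ordered path dz≡1+dy (z ∷ʳ qr⊆zs))
        , (λ dy≡1+dz → path-ascent-persists (unique , linked) (refl ∷ qr⊆zs)
                                              (<-trans (≡suc⇒< dy≡1+dz) dp<dq)) ]′ (adj⇒dist-suc yz)

      fork-profile : ∀ {a b c d e} → Adj G a b → Adj G a d → Adj G a e → Adj G e c →
                     b ≢ d → b ≢ e → a ≢ c →
                     (dist a < dist b × dist d ≤ dist b) ⊎ (dist b < dist c × dist d ≤ dist c)
      fork-profile {a} {b} {c} {d} {e} ab ad ae ec b≢d b≢e a≢c with adj⇒dist-suc ab
      ... | inj₁ db≡1+da =
        inj₁ (≡suc⇒< db≡1+da , subst (dist d ≤_) (sym db≡1+da) (dist-adj (Adj-sym ad)))
      ... | inj₂ da≡1+db = inj₂ (db<dc , dd≤dc)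
        where
        open ≤-Reasoning
        de≡1+da : dist e ≡ suc (dist a)
        de≡1+da = ascent-continues (Adj-sym ab) ae b≢e da≡1+db
        dc≡1+de : dist c ≡ suc (dist e)
        dc≡1+de = ascent-continues ae ec a≢c de≡1+da
        db<dc : dist b < dist c
        db<dc = begin-strict
          dist b  <⟨ ≡suc⇒< da≡1+db ⟩
          dist a  <⟨ ≡suc⇒< de≡1+da ⟩
          dist e  <⟨ ≡suc⇒< dc≡1+de ⟩
          dist c  ∎
        dd≤dc : dist d ≤ dist c
        dd≤dc = begin
          dist d  ≡⟨ trans (ascent-continues (Adj-sym ab) ad b≢d da≡1+db) (sym de≡1+da) ⟩
          dist e  ≤⟨ n≤1+n (dist e) ⟩
          suc (dist e) ≡⟨ dc≡1+de ⟨
          dist c  ∎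

consistent-dist-agree : ∀ {n} (Q H : Graph n) {T₀ T₁ : Graph n} {u v k₀ k₁} →
                        Consistent Q H T₀ → Consistent Q H T₁ →
                        Adj Q u v → Dist T₀ u v k₀ → Dist T₁ u v k₁ → k₀ ≡ k₁
consistent-dist-agree Q H {T₀} {T₁} C₀ C₁ quv d₀ d₁ with C₀ _ _ quv | C₁ _ _ quv
... | _ , dH , d₀′ | _ , dH′ , d₁′ =
  trans (Dist-unique T₀ d₀ d₀′) (trans (Dist-unique H dH dH′) (Dist-unique T₁ d₁′ d₁))

lemma2p9 : (n : ℕ) → 13 ≤ n → (Q H : Graph n) → MinDegreeAtLeast Q (n ∸ 3) → IsTree H →
    ¬ (Σ (Graph n) λ T₀ → Σ (Graph n) λ T₁ → Σ (Fin n) λ a → Σ (Fin n) λ b → Σ (Fin n) λ c → Σ (Fin n) λ d →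
        IsTree T₀ × IsTree T₁ × Consistent Q H T₀ × Consistent Q H T₁ ×
        a ≢ b × a ≢ c × a ≢ d × b ≢ c × b ≢ d × c ≢ d ×
        OnPathInOrder T₀ a b c d ×
        Adj T₁ b a × Adj T₁ a d × Dist T₁ a c 2 × ¬ Adj T₁ c b × ¬ Adj T₁ c d)
lemma2p9 n 13≤n Q H δ _
  (T₀ , T₁ , a , b , c , d , (connected₀ , acyclic₀) , (connected₁ , acyclic₁) , C₀ , C₁ ,
   _ , a≢c , _ , _ , b≢d , _ , (P , path , abcd⊆P) ,
   ba , ad , (cons {z = e} ae (cons ec nil) , _) , ¬cb , _)
  with common-neighbour Q {3} δ (a ∷ b ∷ c ∷ d ∷ []) 13≤n
... | x , Qax ∷ Qbx ∷ Qcx ∷ Qdx ∷ [] =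
  [ uncurry (no-peak-on-P Qax Qbx Qdx (⊆-trans (refl ∷ refl ∷ c ∷ʳ refl ∷ []) abcd⊆P))
  , uncurry (no-peak-on-P Qbx Qcx Qdx (⊆-trans (a ∷ʳ ⊆-refl) abcd⊆P)) ]′
  (D₁.fork-profile acyclic₁ (Adj-sym T₁ ba) ad ae ec b≢d b≢e a≢c)
  where
  module D₀ = Distance T₀ connected₀ x
  module D₁ = Distance T₁ connected₁ x
  b≢e : b ≢ e
  b≢e b≡e = ¬cb (Adj-sym T₁ (subst (λ t → Adj T₁ t c) (sym b≡e) ec))
  agree : ∀ {v} → Adj Q v x → D₁.dist v ≡ D₀.dist v
  agree {v} Qvx = consistent-dist-agree Q H C₁ C₀ Qvx (D₁.dist-spec v) (D₀.dist-spec v)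
  no-peak-on-P : ∀ {p q r} → Adj Q p x → Adj Q q x → Adj Q r x → (p ∷ q ∷ r ∷ []) ⊆ P →
                 D₁.dist p < D₁.dist q → D₁.dist r ≤ D₁.dist q → ⊥
  no-peak-on-P Qpx Qqx Qrx pqr⊆P p<q r≤q =
    <⇒≱ (D₀.path-ascent-persists acyclic₀ path pqr⊆P (subst₂ _<_ (agree Qpx) (agree Qqx) p<q))
        (subst₂ _≤_ (agree Qrx) (agree Qqx) r≤q)
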